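{- Let $G=(V_G,E_G)$ and $H=(V_H,E_H)$ be finite simple connected graphs with $V_G=\{x_1,\ldots,x_n\}$, $n\ge2$, and $|V_H|\ge 2$. Then, identifying the vertex $(y_1,\ldots,y_n)x$ of $G\wr H$ with the vertex $(y_1,\ldots,y_n,x)$ of $A(H)^{\times n}\times A_{Ha}(G)$, $$A(G\wr H)=A(H)^{\times n}\times A_{Ha}(G).$$
   Context: The wreath product $G\wr H$ has vertex set $\{(f,v): f:V_G\to V_H,\ v\in V_G\}$; $(f,v)$ and $(f',v')$ are adjacent iff either $v=v'$, $f(w)=f'(w)$ for $w\neq v$ and $f(v)\sim f'(v)$ in $H$, or $f=f'$ and $v\sim v'$ in $G$; the vertex $(f,x_i)$ is written $(y_1,\ldots,y_n)x_i$ with $y_j=f(x_j)$. For a connected graph $X$, the antipodal graph $A(X)$ has vertex set $V_X$, with $u\sim v$ iff $d_X(u,v)=diam(X)$ ($d_X$ the geodesic distance). For $u,v\in V_G$, $d_{Ha}(u,v)$ is the minimum length of a walk in $G$ from $u$ to $v$ (vertex repetitions allowed) visiting every vertex of $G$; $diam_{Ha}(G)=\max_{u,v}d_{Ha}(u,v)$; the Hamiltonian antipodal graph $A_{Ha}(G)$ has vertex set $V_G$, with $u$ and $v$ (possibly $u=v$, giving a loop) adjacent iff $d_{Ha}(u,v)=diam_{Ha}(G)$. The direct product $X\times Y$ of graphs (loops allowed) has vertex set $V_X\times V_Y$, with $(a,b)\sim(a',b')$ iff $a\sim a'$ in $X$ and $b\sim b'$ in $Y$ (where a loop at $a$ means $a\sim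 a$); $X^{\times n}$ is the $n$-fold direct power. -}

module Defs where

open import Data.Nat using (ℕ; zero; suc; _≤_)
open import Data.Fin using (Fin)
open import Data.Vec using (Vec; lookup)
open import Data.Product using (Σ; _×_; _,_; ∃)
open import Data.Sum using (_⊎_)
open import Relation.Binary.PropositionalEquality using (_≡_; _≢_)
open import Relation.Nullary using (¬_)
open import Relation.Binary using (Decidable)

module _ {V : Set} (E : V → V → Set) where

  data Walk : V → V → Set where
    [] : ∀ {u} → Walk u u
    _∷_ : ∀ {u v w} → E u v → Walk v w → Walk u w

  len : ∀ {u v} → Walk u v → ℕ
  len [] = zero
  len (_ ∷ p) = suc (len p)

  data _∈W_ : ∀ {u v} → V → Walk u v → Set where
    here-nil : ∀ {u} → u ∈W ([] {u})
    here : ∀ {u v w} {e : E u v} {p : Walk v w} → u ∈W (e ∷ p)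
    there : ∀ {x u v w} {e : E u v} {p : Walk v w} → x ∈W p → x ∈W (e ∷ p)

  Spanning : ∀ {u v} → Walk u v → Set
  Spanning p = ∀ x → x ∈W p

  Connected : Set
  Connected = ∀ u v → Walk u v

  IsDist : V → V → ℕ → Set
  IsDist u v k = (Σ (Walk u v) λ p → len p ≡ k) × (∀ (p : Walk u v) → k ≤ len p)

  IsDiam : ℕ → Set
  IsDiam D = (Σ V λ u → Σ V λ v → IsDist u v D)
           × (∀ u v k → IsDist u v k → k ≤ D)

  AntiAdj : V → V → Set
  AntiAdj u v = Σ ℕ λ D → IsDiam D × IsDist u v D

  IsHaDist : V → V → ℕ → Set
  IsHaDist u v k = (Σ (Walk u v) λ p → Spanning p × len p ≡ k)
                 × (∀ (p : Walk u v) → Spanning p → k ≤ len p)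

  IsHaDiam : ℕ → Set
  IsHaDiam D = (Σ V λ u → Σ V λ v → IsHaDist u v D)
             × (∀ u v k → IsHaDist u v k → k ≤ D)

  -- Hamiltonian antipodal graph adjacency (loops allowed)
  HaAntiAdj : V → V → Set
  HaAntiAdj u v = Σ ℕ λ D → IsHaDiam D × IsHaDist u v D

record SimpleGraph (n : ℕ) : Set₁ where
  field
    Adj    : Fin n → Fin n → Set
    adj?   : Decidable Adj
    sym    : ∀ {u v} → Adj u v → Adj v u
    irrefl : ∀ {u} → ¬ Adj u u

open SimpleGraph public

-- Wreath product G ≀ H, G on Fin n, H on Fin m.
-- Vertex (f , v) with f : Fin n → Fin m represented as a vector
-- (y₁,…,yₙ) = (f x₁,…,f xₙ); v ∈ V_G.

WVertex : ℕ → ℕ → Set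
WVertex n m = Vec (Fin m) n × Fin n

WAdj : ∀ {n m} → SimpleGraph n → SimpleGraph m → WVertex n m → WVertex n m → Set
WAdj G H (f , v) (f' , v') =
    (v ≡ v' × (∀ w → w ≢ v → lookup f w ≡ lookup f' w)
            × Adj H (lookup f v) (lookup f' v))
  ⊎ (f ≡ f' × Adj G v v')

-- Think of (f , x) as lamps f on the vertices of G, valued in V_H, with a lighter standing
-- at x.  To get from (f , x) to (f' , x') the lighter must walk from x to x' through every
-- vertex where f and f' differ, and lamp i needs at least d_H(f i, f' i) switches; conversely,
-- a walk q doing this, switching each lamp along an H-geodesic at its first visit, gives a
-- path of length len q + Σᵢ d_H(f i, f' i).  So all distances are at most
-- diam_Ha(G) + n · diam(H), with equality exactly when every lamp pair is H-antipodal and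
-- d_Ha(x, x') = diam_Ha(G): as |V_H| ≥ 2, antipodal lamps differ, so the walk must span G.

module Submission where

open import Defs
open import Data.Nat using (ℕ; zero; suc; _+_; _≤_; _<_; z≤n; s≤s)
open import Data.Nat.Properties
  using (≤-trans; ≤-antisym; ≤-reflexive; +-mono-≤; +-monoˡ-≤; +-monoʳ-≤; +-cancelˡ-≤; +-cancelʳ-≤;
         suc-injective; +-identityʳ; +-suc; +-comm; ≮⇒≥; anyUpTo?; +-0-commutativeMonoid;
         module ≤-Reasoning)
open import Data.Nat.Induction using (<-rec)
open import Data.Fin using (Fin; zero; suc; _≟_)
open import Data.Fin.Properties using (any?; all?; punchInᵢ≢i)
open import Data.Vec using (Vec; lookup; _[_]≔_; replicate)
open import Data.Vec.Properties
  using (lookup∘update; lookup∘update′; lookup-replicate; []≔-idempotent; []≔-lookup)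
open import Data.Vec.Relation.Binary.Pointwise.Extensional using (ext; Pointwise-≡⇒≡)
open import Data.Vec.Functional using (Vector; removeAt)
import Data.List as List
open import Data.List using (List; allFin; cartesianProduct)
open import Data.List.Extrema.Nat using (argmax; f[xs]≤f[argmax])
open import Data.List.Membership.Propositional using () renaming (_∈_ to _∈ˡ_)
open import Data.List.Membership.Propositional.Properties using (∈-allFin; ∈-cartesianProduct⁺)
import Data.List.Relation.Unary.All as All
open import Data.List.Relation.Unary.Any using (here; there)
open import Data.Product using (Σ; ∃; _×_; _,_; proj₁; proj₂; uncurry)
open import Data.Sum using (inj₁; inj₂)
open import Data.Empty using (⊥; ⊥-elim)
open import Data.Unit using (⊤; tt)
open import Relation.Nullary using (Dec; yes; no; ¬?)
open import Relation.Nullary.Decidable using (map′; _×-dec_; _→-dec_)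
open import Relation.Unary using (Pred) renaming (Decidable to Decidable¹)
open import Relation.Binary using (Decidable)
open import Relation.Binary.PropositionalEquality
  using (_≡_; _≢_; refl; cong; cong₂; subst; module ≡-Reasoning)
import Relation.Binary.PropositionalEquality as ≡
open import Data.Nat.Tactic.RingSolver using (solve-∀)
open import Function.Bundles using (_⇔_; mk⇔; module Equivalence)
open import Data.Product.Function.NonDependent.Propositional using (_×-⇔_)
open import Function.Construct.Composition using (_⇔-∘_)
open import Function.Properties.Equivalence using () renaming (sym to ⇔-sym)
open import Algebra.Properties.CommutativeMonoid.Sum +-0-commutativeMonoid
  using (sum; sum-cong-≗; sum-remove; sum-replicate-zero)

minimal : ∀ {p} {P : Pred ℕ p} → Decidable¹ P → ∀ {k} → P k →
          ∃ λ m → P m × (∀ {j} → P j → m ≤ j)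
minimal {p} {P} P? {k} = <-rec Goal descend k
  where
  Goal : ℕ → Set p
  Goal k = P k → ∃ λ m → P m × (∀ {j} → P j → m ≤ j)

  descend : ∀ k → (∀ {j} → j < k → Goal j) → Goal k
  descend k below pk with anyUpTo? P? k
  ... | yes (j , j<k , pj) = below j<k pj
  ... | no none = k , pk , λ {j} pj → ≮⇒≥ (λ j<k → none (j , j<k , pj))

+-tight : ∀ {a A b B} → a ≤ A → b ≤ B → A + B ≤ a + b → a ≡ A × b ≡ B
+-tight {a} {A} {b} {B} a≤A b≤B A+B≤a+b =
  ≤-antisym a≤A (+-cancelʳ-≤ B A a (≤-trans A+B≤a+b (+-monoʳ-≤ a b≤B))) ,
  ≤-antisym b≤B (+-cancelˡ-≤ A B b (≤-trans A+B≤a+b (+-monoˡ-≤ b a≤A)))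

sum-mono-≤ : ∀ {n} {s t : Vector ℕ n} → (∀ i → s i ≤ t i) → sum s ≤ sum t
sum-mono-≤ {zero} s≤t = z≤n
sum-mono-≤ {suc n} s≤t = +-mono-≤ (s≤t zero) (sum-mono-≤ (λ i → s≤t (suc i)))

sum-tight : ∀ {n} {s t : Vector ℕ n} → (∀ i → s i ≤ t i) → sum t ≤ sum s → ∀ i → s i ≡ t i
sum-tight {suc n} s≤t ∑t≤∑s i with +-tight (s≤t zero) (sum-mono-≤ (λ j → s≤t (suc j))) ∑t≤∑s
sum-tight {suc n} s≤t ∑t≤∑s zero | head≡ , _ = head≡
sum-tight {suc n} s≤t ∑t≤∑s (suc i) | _ , tail≡ =
  sum-tight (λ j → s≤t (suc j)) (≤-reflexive (≡.sym tail≡)) i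

sum-swap : ∀ {n} (s t : Vector ℕ (suc n)) i → (∀ j → j ≢ i → s j ≡ t j) →
           sum s + t i ≡ sum t + s i
sum-swap s t i agree = begin
  sum s + t i                   ≡⟨ cong (_+ t i) (sum-remove s) ⟩
  s i + sum (removeAt s i) + t i ≡⟨ cong (λ r → s i + r + t i) rest≡ ⟩
  s i + sum (removeAt t i) + t i ≡⟨ swap-ends (s i) _ (t i) ⟩
  t i + sum (removeAt t i) + s i ≡⟨ cong (_+ s i) (≡.sym (sum-remove t)) ⟩
  sum t + s i                   ∎
  where
  open ≡-Reasoning
  rest≡ : sum (removeAt s i) ≡ sum (removeAt t i)
  rest≡ = sum-cong-≗ (λ j → agree _ (punchInᵢ≢i i j))

  swap-ends : ∀ a r b → a + r + b ≡ b + r + a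
  swap-ends = solve-∀

∀-⇔ : ∀ {A : Set} {P Q : A → Set} → (∀ a → P a ⇔ Q a) → (∀ a → P a) ⇔ (∀ a → Q a)
∀-⇔ P⇔Q = mk⇔ (λ p a → Equivalence.to (P⇔Q a) (p a)) (λ q a → Equivalence.from (P⇔Q a) (q a))

module Walks {V : Set} (E : V → V → Set) where

  infix 4 _∈_
  _∈_ : ∀ {u v} → V → Walk E u v → Set
  x ∈ p = _∈W_ E x p

  infixr 5 _++_
  _++_ : ∀ {u v w} → Walk E u v → Walk E v w → Walk E u w
  [] ++ q = q
  (e ∷ p) ++ q = e ∷ (p ++ q)

  len-++ : ∀ {u v w} (p : Walk E u v) (q : Walk E v w) → len E (p ++ q) ≡ len E p + len E q
  len-++ [] q = refl
  len-++ (e ∷ p) q = cong suc (len-++ p q)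

  ∈-++⁺ʳ : ∀ {x u v w} (p : Walk E u v) {q : Walk E v w} → x ∈ q → x ∈ p ++ q
  ∈-++⁺ʳ [] x∈q = x∈q
  ∈-++⁺ʳ (e ∷ p) x∈q = there (∈-++⁺ʳ p x∈q)

  start-∈ : ∀ {u v} (p : Walk E u v) → u ∈ p
  start-∈ [] = here-nil
  start-∈ (e ∷ p) = here

  ∈-[]⁻ : ∀ {x u} → x ∈ [] {u = u} → x ≡ u
  ∈-[]⁻ here-nil = refl

  ∈-∷⁻ : ∀ {x u v w} {e : E u v} {p : Walk E v w} → x ∈ e ∷ p → x ≢ u → x ∈ p
  ∈-∷⁻ here x≢u = ⊥-elim (x≢u refl)
  ∈-∷⁻ (there x∈p) _ = x∈p

  walk-through : Connected E → (xs : List V) → ∀ u v →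
                 Σ (Walk E u v) λ p → ∀ {x} → x ∈ˡ xs → x ∈ p
  walk-through conn List.[] u v = conn u v , λ ()
  walk-through conn (y List.∷ ys) u v with walk-through conn ys y v
  ... | q , ys⊆q = conn u y ++ q , λ where
    (here refl) → ∈-++⁺ʳ (conn u y) (start-∈ q)
    (there x∈ys) → ∈-++⁺ʳ (conn u y) (ys⊆q x∈ys)

  IsDist-functional : ∀ {u v k k'} → IsDist E u v k → IsDist E u v k' → k ≡ k'
  IsDist-functional ((p , refl) , k≤) ((p' , refl) , k'≤) = ≤-antisym (k≤ p') (k'≤ p)

  IsHaDist-functional : ∀ {u v k k'} → IsHaDist E u v k → IsHaDist E u v k' → k ≡ k'
  IsHaDist-functional ((p , sp , refl) , k≤) ((p' , sp' , refl) , k'≤) =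
    ≤-antisym (k≤ p' sp') (k'≤ p sp)

-- IsDiam E and AntiAdj E unfold to IsMax (IsDist E) and Attains (IsDist E); likewise
-- IsHaDiam E and HaAntiAdj E for IsHaDist E.
module Extremal {V : Set} (R : V → V → ℕ → Set) where

  IsMax : ℕ → Set
  IsMax D = (Σ V λ u → Σ V λ v → R u v D) × (∀ u v k → R u v k → k ≤ D)

  Attains : V → V → Set
  Attains u v = Σ ℕ λ D → IsMax D × R u v D

  Functional : Set
  Functional = ∀ {u v k k'} → R u v k → R u v k' → k ≡ k'

  IsMax-unique : ∀ {D D'} → IsMax D → IsMax D' → D ≡ D'
  IsMax-unique ((u , v , r) , ≤D) ((u' , v' , r') , ≤D') = ≤-antisym (≤D' u v _ r) (≤D u' v' _ r')

  Attains⇔ : ∀ {D u v} → IsMax D → Attains u v ⇔ R u v D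
  Attains⇔ {D} max = mk⇔ (λ (D' , max' , r) → subst (R _ _) (IsMax-unique max' max) r)
                          (λ r → D , max , r)

  R⇔≡ : Functional → (d : V → V → ℕ) → (∀ u v → R u v (d u v)) →
        ∀ {u v k} → R u v k ⇔ d u v ≡ k
  R⇔≡ functional d d-spec {u} {v} = mk⇔ (functional (d-spec u v)) (λ { refl → d-spec u v })

argmax² : ∀ {K} (d : Fin (suc K) → Fin (suc K) → ℕ) →
          Σ (Fin (suc K) × Fin (suc K)) λ (a , b) → ∀ u v → d u v ≤ d a b
argmax² {K} d = ab , λ u v →
  All.lookup (f[xs]≤f[argmax] {f = uncurry d} (zero , zero) pairs)
             (∈-cartesianProduct⁺ (∈-allFin u) (∈-allFin v))
  where
  pairs = cartesianProduct (allFin (suc K)) (allFin (suc K))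
  ab = argmax (uncurry d) (zero , zero) pairs

module FiniteMaximum {K} {R : Fin (suc K) → Fin (suc K) → ℕ → Set}
                     (functional : Extremal.Functional R)
                     (d : Fin (suc K) → Fin (suc K) → ℕ) (d-spec : ∀ u v → R u v (d u v)) where
  open Extremal R

  opaque
    top : Σ (Fin (suc K) × Fin (suc K)) λ (a , b) → ∀ u v → d u v ≤ d a b
    top = argmax² d

  max : ℕ
  max = uncurry d (proj₁ top)

  ≤-max : ∀ u v → d u v ≤ max
  ≤-max = proj₂ top

  max-attained : Σ (Fin (suc K)) λ a → Σ (Fin (suc K)) λ b → d a b ≡ max
  max-attained = proj₁ (proj₁ top) , proj₂ (proj₁ top) , refl

  isMax : IsMax max
  isMax = (_ , _ , d-spec _ _) , λ u v k r → subst (_≤ max) (functional (d-spec u v) r) (≤-max u v)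

module FiniteGraph {K : ℕ} (E : Fin (suc K) → Fin (suc K) → Set) (E? : Decidable E)
                   (connected : Connected E) where
  open Walks E

  Covers : ∀ {u v} → (Fin (suc K) → Set) → Walk E u v → Set
  Covers C p = ∀ x → C x → x ∈ p

  CoveringWalk : (Fin (suc K) → Set) → ℕ → Fin (suc K) → Fin (suc K) → Set
  CoveringWalk C ℓ u v = Σ (Walk E u v) λ p → len E p ≡ ℓ × Covers C p

  covering-walk? : ∀ {C} → Decidable¹ C → ∀ ℓ u v → Dec (CoveringWalk C ℓ u v)
  covering-walk? C? zero u v with u ≟ v
  ... | no u≢v = no λ { ([] , _ , _) → u≢v refl }
  ... | yes refl =
    map′ (λ C⊆u → [] , refl , λ x cx → subst (_∈ []) (≡.sym (C⊆u x cx)) here-nil)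
         (λ { ([] , _ , cov) x cx → ∈-[]⁻ (cov x cx) })
         (all? λ x → C? x →-dec x ≟ u)
  covering-walk? {C} C? (suc ℓ) u v =
    map′ (λ (w , e , p , lp , cov) → e ∷ p , cong suc lp , cover-∷ cov)
         (λ { (_∷_ {v = w} e p , lp , cov) → w , e , p , suc-injective lp ,
                                               λ x (cx , x≢u) → ∈-∷⁻ (cov x cx) x≢u })
         (any? λ w → E? u w ×-dec covering-walk? (λ x → C? x ×-dec ¬? (x ≟ u)) ℓ w v)
    where
    cover-∷ : ∀ {w} {e : E u w} {p : Walk E w v} →
              Covers (λ x → C x × x ≢ u) p → Covers C (e ∷ p)
    cover-∷ cov x cx with x ≟ u
    ... | yes refl = here
    ... | no x≢u = there (cov x (cx , x≢u))

  shortest-covering : ∀ {C} → Decidable¹ C → ∀ {u v} (p : Walk E u v) → Covers C p →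
    Σ ℕ λ ℓ → CoveringWalk C ℓ u v × (∀ q → Covers C q → ℓ ≤ len E q)
  shortest-covering C? {u} {v} p cov with minimal (λ ℓ → covering-walk? C? ℓ u v) (p , refl , cov)
  ... | ℓ , walk , least = ℓ , walk , λ q cov-q → least (q , refl , cov-q)

  -- Opaque, since unfolding the exhaustive search makes unification blow up.
  opaque
    distance : ∀ u v → Σ ℕ (IsDist E u v)
    distance u v with shortest-covering {C = λ _ → ⊥} (λ _ → no λ ()) (connected u v) (λ _ ())
    ... | ℓ , (p , lp , _) , least = ℓ , (p , lp) , λ q → least q (λ _ ())

    haDistance : ∀ u v → Σ ℕ (IsHaDist E u v)
    haDistance u v with walk-through connected (allFin (suc K)) u v
    ... | p , spans
      with shortest-covering {C = λ _ → ⊤} (λ _ → yes tt) p (λ x _ → spans (∈-allFin x))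
    ... | ℓ , (q , lq , cov) , least =
      ℓ , (q , (λ x → cov x tt) , lq) , λ q' spans' → least q' (λ x _ → spans' x)

  dist : Fin (suc K) → Fin (suc K) → ℕ
  dist u v = proj₁ (distance u v)

  isDist : ∀ u v → IsDist E u v (dist u v)
  isDist u v = proj₂ (distance u v)

  dist-minimal : ∀ {u v} (p : Walk E u v) → dist u v ≤ len E p
  dist-minimal {u} {v} = proj₂ (isDist u v)

  dist-refl : ∀ u → dist u u ≡ 0
  dist-refl u = ≤-antisym (dist-minimal []) z≤n

  dist-step : ∀ {u v} w → E u v → dist u w ≤ suc (dist v w)
  dist-step {v = v} w e with isDist v w
  ... | (p , lp) , _ = subst (λ ℓ → _ ≤ suc ℓ) lp (dist-minimal (e ∷ p))

  dist-pos : ∀ {u v} → u ≢ v → 1 ≤ dist u v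
  dist-pos {u} {v} u≢v with isDist u v
  ... | ([] , _) , _ = ⊥-elim (u≢v refl)
  ... | (e ∷ p , lp) , _ = subst (1 ≤_) lp (s≤s z≤n)

  haDist : Fin (suc K) → Fin (suc K) → ℕ
  haDist u v = proj₁ (haDistance u v)

  isHaDist : ∀ u v → IsHaDist E u v (haDist u v)
  isHaDist u v = proj₂ (haDistance u v)

  open FiniteMaximum IsDist-functional dist isDist public
    using () renaming (max to diam; ≤-max to dist≤diam; max-attained to diam-attained;
                       isMax to isDiam)
  open FiniteMaximum IsHaDist-functional haDist isHaDist public
    using () renaming (max to haDiam; ≤-max to haDist≤haDiam; max-attained to haDiam-attained;
                       isMax to isHaDiam)

  diam-pos : ∀ {u v} → u ≢ v → 1 ≤ diam
  diam-pos u≢v = ≤-trans (dist-pos u≢v) (dist≤diam _ _)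

  antipodal⇒≢ : ∀ {u v} → 1 ≤ diam → dist u v ≡ diam → u ≢ v
  antipodal⇒≢ 1≤diam far refl with subst (1 ≤_) (≡.trans (≡.sym far) (dist-refl _)) 1≤diam
  ... | ()

  antipodal⇔ : ∀ {u v} → AntiAdj E u v ⇔ dist u v ≡ diam
  antipodal⇔ = R⇔≡ (IsDist E) IsDist-functional dist isDist ⇔-∘ Attains⇔ (IsDist E) isDiam
    where open Extremal

  haAntipodal⇔ : ∀ {u v} → HaAntiAdj E u v ⇔ haDist u v ≡ haDiam
  haAntipodal⇔ =
    R⇔≡ (IsHaDist E) IsHaDist-functional haDist isHaDist ⇔-∘ Attains⇔ (IsHaDist E) isHaDiam
    where open Extremal

module Wreath {n' m' : ℕ} (G : SimpleGraph (suc n')) (H : SimpleGraph (suc (suc m')))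
              (G-connected : Connected (Adj G)) (H-connected : Connected (Adj H)) where

  private
    n m : ℕ
    n = suc n'
    m = suc (suc m')
    W = WAdj G H

  module G = FiniteGraph (Adj G) (adj? G) G-connected
  module H = FiniteGraph (Adj H) (adj? H) H-connected
  open Walks (Adj G) using (start-∈; ∈-[]⁻; ∈-∷⁻) renaming (_∈_ to _∈ᴳ_)
  open Walks W using (_++_; len-++)

  Lamps : Set
  Lamps = Vec (Fin m) n

  δ : Lamps → Lamps → Fin n → ℕ
  δ f f' i = H.dist (lookup f i) (lookup f' i)

  Δ : Lamps → Lamps → ℕ
  Δ f f' = sum (δ f f')

  AgreeOff : Fin n → Lamps → Lamps → Set
  AgreeOff x g g' = ∀ i → i ≢ x → lookup g i ≡ lookup g' i

  VisitsDifferences : ∀ {x x'} → Walk (Adj G) x x' → Lamps → Lamps → Set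
  VisitsDifferences q f f' = ∀ i → lookup f i ≢ lookup f' i → i ∈ᴳ q

  Δ-self : ∀ f → Δ f f ≡ 0
  Δ-self f = ≡.trans (sum-cong-≗ (λ i → H.dist-refl (lookup f i))) (sum-replicate-zero n)

  Δ-swap : ∀ g g' f' x → AgreeOff x g g' → Δ g f' + δ g' f' x ≡ Δ g' f' + δ g f' x
  Δ-swap g g' f' x agree =
    sum-swap _ _ x (λ i i≢x → cong (λ y → H.dist y (lookup f' i)) (agree i i≢x))

  update-agreeOff : ∀ g x b → AgreeOff x g (g [ x ]≔ b)
  update-agreeOff g x b i i≢x = ≡.sym (lookup∘update′ i≢x g b)

  relight : ∀ {a b} (r : Walk (Adj H) a b) (g : Lamps) x → lookup g x ≡ a →
            Σ (Walk W (g , x) (g [ x ]≔ b , x)) λ p → len W p ≡ len (Adj H) r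
  relight [] g x refl rewrite []≔-lookup g x = [] , refl
  relight {b = b} (_∷_ {v = c} e r) g x refl rewrite ≡.sym ([]≔-idempotent {x = c} {y = b} g x)
    with relight r (g [ x ]≔ c) x (lookup∘update x g c)
  ... | p , lp = switch ∷ p , cong suc lp
    where
    switch : W (g , x) (g [ x ]≔ c , x)
    switch = inj₁ (refl , update-agreeOff g x c ,
                   subst (Adj H (lookup g x)) (≡.sym (lookup∘update x g c)) e)

  fix-lamp : ∀ g f' x → let g' = g [ x ]≔ lookup f' x in
             Σ (Walk W (g , x) (g' , x)) λ p → len W p + Δ g' f' ≡ Δ g f'
  fix-lamp g f' x with H.isDist (lookup g x) (lookup f' x)
  ... | (r , lr) , _ with relight r g x refl
  ... | p , lp = p , (begin
    len W p + Δ g' f'      ≡⟨ +-comm (len W p) _ ⟩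
    Δ g' f' + len W p      ≡⟨ cong (Δ g' f' +_) (≡.trans lp lr) ⟩
    Δ g' f' + δ g f' x     ≡⟨ Δ-swap g g' f' x (update-agreeOff g x _) ⟨
    Δ g f' + δ g' f' x     ≡⟨ cong (λ y → Δ g f' + H.dist y (lookup f' x)) (lookup∘update x g _) ⟩
    Δ g f' + δ f' f' x     ≡⟨ cong (Δ g f' +_) (H.dist-refl _) ⟩
    Δ g f' + 0             ≡⟨ +-identityʳ _ ⟩
    Δ g f'                 ∎)
    where
    open ≡-Reasoning
    g' = g [ x ]≔ lookup f' x

  only-lamp-left : ∀ {x} (g f' : Lamps) → VisitsDifferences ([] {u = x}) g f' →
                   g [ x ]≔ lookup f' x ≡ f'
  only-lamp-left {x} g f' visits = Pointwise-≡⇒≡ (ext fixed-at)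
    where
    fixed-at : ∀ i → lookup (g [ x ]≔ lookup f' x) i ≡ lookup f' i
    fixed-at i with i ≟ x
    ... | yes refl = lookup∘update i g _
    ... | no i≢x with lookup g i ≟ lookup f' i
    ...   | yes gi≡f'i = ≡.trans (lookup∘update′ i≢x g _) gi≡f'i
    ...   | no gi≢f'i = ⊥-elim (i≢x (∈-[]⁻ (visits i gi≢f'i)))

  visiting-walk : ∀ {x x'} (q : Walk (Adj G) x x') (g f' : Lamps) → VisitsDifferences q g f' →
    Σ (Walk W (g , x) (f' , x')) λ p → len W p ≡ len (Adj G) q + Δ g f'
  visiting-walk {x} [] g f' visits with fix-lamp g f' x
  ... | p , lp rewrite only-lamp-left g f' visits = p , (begin
    len W p                ≡⟨ +-identityʳ _ ⟨
    len W p + 0            ≡⟨ cong (len W p +_) (Δ-self f') ⟨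
    len W p + Δ f' f'      ≡⟨ lp ⟩
    Δ g f'                 ∎)
    where
    open ≡-Reasoning
  visiting-walk {x} (e ∷ q) g f' visits with fix-lamp g f' x
  ... | p , lp with visiting-walk q (g [ x ]≔ lookup f' x) f' visits-rest
    where
    visits-rest : VisitsDifferences q (g [ x ]≔ lookup f' x) f'
    visits-rest i g'i≢f'i with i ≟ x
    ... | yes refl = ⊥-elim (g'i≢f'i (lookup∘update i g _))
    ... | no i≢x =
      ∈-∷⁻ (visits i (λ gi≡f'i → g'i≢f'i (≡.trans (lookup∘update′ i≢x g _) gi≡f'i))) i≢x
  ... | p' , lp' = p ++ inj₂ (refl , e) ∷ p' , (begin
    len W (p ++ inj₂ (refl , e) ∷ p')           ≡⟨ len-++ p _ ⟩
    len W p + suc (len W p')                    ≡⟨ cong (λ ℓ → len W p + suc ℓ) lp' ⟩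
    len W p + suc (len (Adj G) q + Δ g' f')     ≡⟨ rearrange (len W p) (len (Adj G) q) (Δ g' f') ⟩
    suc (len (Adj G) q) + (len W p + Δ g' f')   ≡⟨ cong (suc (len (Adj G) q) +_) lp ⟩
    suc (len (Adj G) q) + Δ g f'                ∎)
    where
    open ≡-Reasoning
    g' = g [ x ]≔ lookup f' x
    rearrange : ∀ a b c → a + suc (b + c) ≡ suc b + (a + c)
    rearrange = solve-∀

  Δ-step : ∀ f g f' x → AgreeOff x f g → Adj H (lookup f x) (lookup g x) → Δ f f' ≤ suc (Δ g f')
  Δ-step f g f' x agree adj = +-cancelʳ-≤ (δ g f' x) _ _ (begin
    Δ f f' + δ g f' x         ≡⟨ Δ-swap f g f' x agree ⟩
    Δ g f' + δ f f' x         ≤⟨ +-monoʳ-≤ (Δ g f') (H.dist-step (lookup f' x) adj) ⟩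
    Δ g f' + suc (δ g f' x)   ≡⟨ +-suc (Δ g f') _ ⟩
    suc (Δ g f') + δ g f' x   ∎)
    where open ≤-Reasoning

  -- Forget the lamp switches; each one lowers Δ by at most 1 (Δ-step).
  projection : ∀ {f x f' x'} (p : Walk W (f , x) (f' , x')) →
    Σ (Walk (Adj G) x x') λ q → VisitsDifferences q f f' × len (Adj G) q + Δ f f' ≤ len W p
  projection {f} [] = [] , (λ i fi≢fi → ⊥-elim (fi≢fi refl)) , ≤-reflexive (Δ-self f)
  projection (inj₂ (refl , e) ∷ p) with projection p
  ... | q , visits , le = e ∷ q , (λ i differ → there (visits i differ)) , s≤s le
  projection {f} {x} {f'} (_∷_ {v = g , x} (inj₁ (refl , agree , adj)) p) with projection p
  ... | q , visits , le = q , visits-f , (begin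
    len (Adj G) q + Δ f f'           ≤⟨ +-monoʳ-≤ (len (Adj G) q) (Δ-step f g f' x agree adj) ⟩
    len (Adj G) q + suc (Δ g f')     ≡⟨ +-suc (len (Adj G) q) _ ⟩
    suc (len (Adj G) q + Δ g f')     ≤⟨ s≤s le ⟩
    suc (len W p)                    ∎)
    where
    open ≤-Reasoning
    visits-f : VisitsDifferences q f f'
    visits-f i fi≢f'i with i ≟ x
    ... | yes refl = start-∈ q
    ... | no i≢x = visits i (λ gi≡f'i → fi≢f'i (≡.trans (agree i i≢x) gi≡f'i))

  Δ-max : ℕ
  Δ-max = sum {n} (λ _ → H.diam)

  Δ≤Δ-max : ∀ f f' → Δ f f' ≤ Δ-max
  Δ≤Δ-max f f' = sum-mono-≤ {n} {t = λ _ → H.diam} (λ i → H.dist≤diam (lookup f i) (lookup f' i))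

  Δ-tight : ∀ f f' → Δ-max ≤ Δ f f' → ∀ i → δ f f' i ≡ H.diam
  Δ-tight f f' = sum-tight {n} {t = λ _ → H.diam} (λ i → H.dist≤diam (lookup f i) (lookup f' i))

  diam : ℕ
  diam = G.haDiam + Δ-max

  tour : ∀ f f' x x' → Σ (Walk W (f , x) (f' , x')) λ p → len W p ≡ G.haDist x x' + Δ f f'
  tour f f' x x' with G.isHaDist x x'
  ... | (q , spans , lq) , _ with visiting-walk q f f' (λ i _ → spans i)
  ... | p , lp = p , ≡.trans lp (cong (_+ Δ f f') lq)

  tour≤diam : ∀ f f' x x' → G.haDist x x' + Δ f f' ≤ diam
  tour≤diam f f' x x' = +-mono-≤ (G.haDist≤haDiam x x') (Δ≤Δ-max f f')

  tour-optimal : ∀ {f f' x x'} → (∀ i → lookup f i ≢ lookup f' i) →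
                 (p : Walk W (f , x) (f' , x')) → G.haDist x x' + Δ f f' ≤ len W p
  tour-optimal {f} {f'} {x} {x'} differ p with projection p
  ... | q , visits , le =
    ≤-trans (+-monoˡ-≤ (Δ f f') (proj₂ (G.isHaDist x x') q (λ i → visits i (differ i)))) le

  Antipodal : Lamps → Lamps → Fin n → Fin n → Set
  Antipodal f f' x x' = (∀ i → δ f f' i ≡ H.diam) × G.haDist x x' ≡ G.haDiam

  antipodal⇒isDist : ∀ {f f' x x'} → Antipodal f f' x x' → IsDist W (f , x) (f' , x') diam
  antipodal⇒isDist {f} {f'} {x} {x'} (far , ha-far) =
    (proj₁ (tour f f' x x') , ≡.trans (proj₂ (tour f f' x x')) tour≡diam) ,
    λ p → subst (_≤ len W p) tour≡diam (tour-optimal differ p)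
    where
    tour≡diam : G.haDist x x' + Δ f f' ≡ diam
    tour≡diam = cong₂ _+_ ha-far (sum-cong-≗ far)
    differ : ∀ i → lookup f i ≢ lookup f' i
    differ i = H.antipodal⇒≢ (H.diam-pos {zero} {suc zero} λ ()) (far i)

  isDist⇒antipodal : ∀ {f f' x x'} → IsDist W (f , x) (f' , x') diam → Antipodal f f' x x'
  isDist⇒antipodal {f} {f'} {x} {x'} (_ , diam≤) with tour f f' x x'
  ... | p , lp with +-tight (G.haDist≤haDiam x x') (Δ≤Δ-max f f') (≤-trans (diam≤ p) (≤-reflexive lp))
  ... | ha-far , Δ-far = Δ-tight f f' (≤-reflexive (≡.sym Δ-far)) , ha-far

  isDiam : IsDiam W diam
  isDiam = ((replicate n a , x) , (replicate n b , x') , antipodal⇒isDist (far , ha-far)) ,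
           λ (g , y) (g' , y') k dist-k →
             ≤-trans (proj₂ dist-k (proj₁ (tour g g' y y')))
                     (≤-trans (≤-reflexive (proj₂ (tour g g' y y'))) (tour≤diam g g' y y'))
    where
    a = proj₁ H.diam-attained
    b = proj₁ (proj₂ H.diam-attained)
    x = proj₁ G.haDiam-attained
    x' = proj₁ (proj₂ G.haDiam-attained)
    far : ∀ i → δ (replicate n a) (replicate n b) i ≡ H.diam
    far i rewrite lookup-replicate i a | lookup-replicate i b = proj₂ (proj₂ H.diam-attained)
    ha-far : G.haDist x x' ≡ G.haDiam
    ha-far = proj₂ (proj₂ G.haDiam-attained)

  antipodal⇔ : ∀ {f f' x x'} → AntiAdj W (f , x) (f' , x') ⇔ Antipodal f f' x x'
  antipodal⇔ = mk⇔ isDist⇒antipodal antipodal⇒isDist ⇔-∘ Extremal.Attains⇔ (IsDist W) isDiam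

theorem4p19 : (n m : ℕ) → 2 ≤ n → 2 ≤ m →
    (G : SimpleGraph n) → (H : SimpleGraph m) →
    Connected (Adj G) → Connected (Adj H) →
    (f f' : Vec (Fin m) n) → (x x' : Fin n) →
    AntiAdj (WAdj G H) (f , x) (f' , x') ⇔
      ((∀ i → AntiAdj (Adj H) (lookup f i) (lookup f' i)) × HaAntiAdj (Adj G) x x')
theorem4p19 _ _ (s≤s (s≤s _)) (s≤s (s≤s _)) G H G-connected H-connected f f' x x' =
  (∀-⇔ (λ _ → ⇔-sym H.antipodal⇔) ×-⇔ ⇔-sym G.haAntipodal⇔) ⇔-∘ antipodal⇔
  where open Wreath G H G-connected H-connected
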